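{- Let $H_0,\ldots,H_n,H'$ be sets of hypotheses over a common alphabet $\Sigma$ and let $H=\bigcup_{i\le n}H_i$. If $H_i$ reduces to $H'$ for all $i\le n$, and $H^\star\subseteq H_n^\star\circ\cdots\circ H_0^\star$ (pointwise), then $H$ reduces to $H'$.
   Context: Regular expressions $T(\Sigma)$: $e,f::=e+f\mid e\cdot f\mid e^*\mid 0\mid 1\mid a$ ($a\in\Sigma$), with usual language $\llbracket e\rrbracket$. Kleene algebra axioms: idempotent semiring axioms plus $1+xx^*\le x^*$, $x+yz\le z\Rightarrow y^*x\le z$, $x+yz\le y\Rightarrow xz^*\le y$. A hypothesis is a pair $e\le f$. $\mathsf{KA}_G\vdash e=f$ means derivable in equational logic from all instances of the Kleene algebra axioms and the hypotheses in $G$, letters being constants (no substitution rule); $\mathsf{KA}_G\vdash G'$ means all inequations of $G'$ are derivable. The $G$-closure $G^\star(L)$ is the smallest language containing $L$ such that for all $e\le f\in G$ and words $u,v$, $u\llbracket f\rrbracket v\subseteq G^\star(L)$ implies $u\llbracket e\rrbracket v\subseteq G^\star(L)$. Over a common alphabet, $G$ reduces to $G'$ if $\mathsf{KA}_G\vdash G'$ and there is $r:T(\Sigma)\to T(\Sigma)$ with $\mathsf{KA}_G\vdash e=r(e)$ and $G^\star(\llbracket e\rrbracket)\subseteq G'^\star(\llbracket r(e)\rrbracket)$ for all $e$. -}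

module Defs where

open import Data.List using (List; []; _++_)
open import Data.Product using (Σ; _×_; ∃; ∃-syntax; _,_)
open import Data.Nat using (ℕ; zero; suc)
open import Data.Fin using (Fin; fromℕ; inject₁)
open import Relation.Binary.PropositionalEquality using (_≡_)

data Exp (A : Set) : Set where
  _⊕_ : Exp A → Exp A → Exp A
  _⊙_ : Exp A → Exp A → Exp A
  _⋆  : Exp A → Exp A
  𝟘 𝟙 : Exp A
  var : A → Exp A

infixl 6 _⊕_
infixl 7 _⊙_
infix 8 _⋆

Word : Set → Set
Word A = List A

Lang : Set → Set₁
Lang A = Word A → Set

data StarL {A : Set} (L : Lang A) : Lang A where
  nil  : StarL L []
  cons : ∀ {u v w} → L u → StarL L v → w ≡ u ++ v → StarL L w

⟦_⟧ : {A : Set} → Exp A → Lang A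
⟦ e ⊕ f ⟧ w = ⟦ e ⟧ w Data.Sum.⊎ ⟦ f ⟧ w
  where import Data.Sum
⟦ e ⊙ f ⟧ w = ∃[ u ] ∃[ v ] (⟦ e ⟧ u × ⟦ f ⟧ v × w ≡ u ++ v)
⟦ e ⋆ ⟧ w = StarL ⟦ e ⟧ w
⟦ 𝟘 ⟧ w = Data.Empty.⊥
  where import Data.Empty
⟦ 𝟙 ⟧ w = w ≡ []
⟦ var a ⟧ w = w ≡ a Data.List.∷ []
  where import Data.List

-- A set of hypotheses: a (possibly infinite) set of pairs e ≤ f
Hyps : Set → Set₁
Hyps A = Exp A → Exp A → Set

-- Derivability in KA_G (equational logic, letters are constants).
-- e ≤ f abbreviates e + f = f.
infix 4 _⊢_≈_ _⊢_≤_
data _⊢_≈_ {A : Set} (G : Hyps A) : Exp A → Exp A → Set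

_⊢_≤_ : {A : Set} → Hyps A → Exp A → Exp A → Set
G ⊢ e ≤ f = G ⊢ e ⊕ f ≈ f

data _⊢_≈_ {A} G where
  refl  : ∀ {e} → G ⊢ e ≈ e
  sym   : ∀ {e f} → G ⊢ e ≈ f → G ⊢ f ≈ e
  trans : ∀ {e f g} → G ⊢ e ≈ f → G ⊢ f ≈ g → G ⊢ e ≈ g
  ⊕-cong : ∀ {e e' f f'} → G ⊢ e ≈ e' → G ⊢ f ≈ f' → G ⊢ e ⊕ f ≈ e' ⊕ f'
  ⊙-cong : ∀ {e e' f f'} → G ⊢ e ≈ e' → G ⊢ f ≈ f' → G ⊢ e ⊙ f ≈ e' ⊙ f'
  ⋆-cong : ∀ {e e'} → G ⊢ e ≈ e' → G ⊢ e ⋆ ≈ e' ⋆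
  ⊕-assoc : ∀ {x y z} → G ⊢ (x ⊕ y) ⊕ z ≈ x ⊕ (y ⊕ z)
  ⊕-comm  : ∀ {x y} → G ⊢ x ⊕ y ≈ y ⊕ x
  ⊕-idem  : ∀ {x} → G ⊢ x ⊕ x ≈ x
  ⊕-zero  : ∀ {x} → G ⊢ x ⊕ 𝟘 ≈ x
  ⊙-assoc : ∀ {x y z} → G ⊢ (x ⊙ y) ⊙ z ≈ x ⊙ (y ⊙ z)
  ⊙-unitˡ : ∀ {x} → G ⊢ 𝟙 ⊙ x ≈ x
  ⊙-unitʳ : ∀ {x} → G ⊢ x ⊙ 𝟙 ≈ x
  distribˡ : ∀ {x y z} → G ⊢ x ⊙ (y ⊕ z) ≈ x ⊙ y ⊕ x ⊙ z
  distribʳ : ∀ {x y z} → G ⊢ (x ⊕ y) ⊙ z ≈ x ⊙ z ⊕ y ⊙ z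
  annihilˡ : ∀ {x} → G ⊢ 𝟘 ⊙ x ≈ 𝟘
  annihilʳ : ∀ {x} → G ⊢ x ⊙ 𝟘 ≈ 𝟘
  ⋆-unfold : ∀ {x} → G ⊢ (𝟙 ⊕ x ⊙ x ⋆) ⊕ x ⋆ ≈ x ⋆
  ⋆-indˡ : ∀ {x y z} → G ⊢ (x ⊕ y ⊙ z) ⊕ z ≈ z → G ⊢ (y ⋆ ⊙ x) ⊕ z ≈ z
  ⋆-indʳ : ∀ {x y z} → G ⊢ (x ⊕ y ⊙ z) ⊕ y ≈ y → G ⊢ (x ⊙ z ⋆) ⊕ y ≈ y
  hyp : ∀ {e f} → G e f → G ⊢ e ⊕ f ≈ f

_⊢ₕ_ : {A : Set} → Hyps A → Hyps A → Set
G ⊢ₕ G' = ∀ {e f} → G' e f → G ⊢ e ≤ f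

data Closure {A : Set} (G : Hyps A) (L : Lang A) : Lang A where
  base : ∀ {w} → L w → Closure G L w
  step : ∀ {e f u v x w} → G e f
       → (∀ y → ⟦ f ⟧ y → Closure G L (u ++ y ++ v))
       → ⟦ e ⟧ x → w ≡ u ++ x ++ v → Closure G L w

Reduces : {A : Set} → Hyps A → Hyps A → Set
Reduces G G' =
  (G ⊢ₕ G') ×
  Σ (Exp _ → Exp _) λ r →
    ∀ e → (G ⊢ e ≈ r e) × (∀ w → Closure G ⟦ e ⟧ w → Closure G' ⟦ r e ⟧ w)

⋃ : {A : Set} (n : ℕ) → (Fin (suc n) → Hyps A) → Hyps A
⋃ n H e f = Σ (Fin (suc n)) λ i → H i e f

ComposeClo : {A : Set} (n : ℕ) → (Fin (suc n) → Hyps A) → Lang A → Lang A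
ComposeClo zero    H L = Closure (H (fromℕ zero)) L
ComposeClo (suc n) H L = Closure (H (fromℕ (suc n))) (ComposeClo n (λ i → H (inject₁ i)) L)

-- Call K G-closed if for every hypothesis e ≤ f in G and all words u, v, u⟦f⟧v ⊆ K implies
-- u⟦e⟧v ⊆ K.  For such K the relation  a ⊑ b :⇔ (u⟦b⟧v ⊆ K ⇒ u⟦a⟧v ⊆ K for all u, v)  is a
-- precongruence validating the Kleene algebra axioms, so it contains every inequation derivable
-- in KA_G.  As G⋆(L) is the least G-closed language containing L, KA_G ⊢ G' yields G'⋆ ⊆ G⋆.
-- The reduction for H is rₙ ∘ ⋯ ∘ r₀: stage i maps Hᵢ⋆ ∘ ⋯ ∘ H₀⋆ (⟦e⟧) into H'⋆ of the current
-- expression, because the previous stage lands in H'⋆ ⊆ Hᵢ⋆ of its input and Hᵢ⋆ is idempotent.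
module Submission where

open import Defs
open import Data.Nat using (ℕ; suc; zero)
open import Data.Fin using (Fin; fromℕ; inject₁)
open import Data.List using ([]; _++_)
open import Data.List.Properties using (++-assoc; ++-identityʳ)
open import Data.Product using (_×_; _,_; proj₁; proj₂; map; zip′; swap)
open import Data.Sum using (inj₁; inj₂)
open import Function using (_∘_; id; flip)
open import Relation.Binary.Core using (_⇒_)
open import Relation.Binary.PropositionalEquality using (refl; cong; subst)
import Relation.Binary.PropositionalEquality as ≡
open import Relation.Unary using (_⊆_; _≐_)

private
  variable
    A : Set
    a a' b b' c : Exp A
    G G' : Hyps A
    L L' : Lang A
    e : Exp A

⊕-assoc-≐ : ⟦ (a ⊕ b) ⊕ c ⟧ ≐ ⟦ a ⊕ (b ⊕ c) ⟧
⊕-assoc-≐ = to , from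
  where
  to : ⟦ (a ⊕ b) ⊕ c ⟧ ⊆ ⟦ a ⊕ (b ⊕ c) ⟧
  to (inj₁ (inj₁ p)) = inj₁ p
  to (inj₁ (inj₂ p)) = inj₂ (inj₁ p)
  to (inj₂ p)        = inj₂ (inj₂ p)
  from : ⟦ a ⊕ (b ⊕ c) ⟧ ⊆ ⟦ (a ⊕ b) ⊕ c ⟧
  from (inj₁ p)        = inj₁ (inj₁ p)
  from (inj₂ (inj₁ p)) = inj₁ (inj₂ p)
  from (inj₂ (inj₂ p)) = inj₂ p

⊕-comm-⊆ : ⟦ a ⊕ b ⟧ ⊆ ⟦ b ⊕ a ⟧
⊕-comm-⊆ (inj₁ p) = inj₂ p
⊕-comm-⊆ (inj₂ p) = inj₁ p

⊕-idem-≐ : ⟦ a ⊕ a ⟧ ≐ ⟦ a ⟧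
⊕-idem-≐ = (λ { (inj₁ p) → p ; (inj₂ p) → p }) , inj₁

⊕-zero-≐ : ⟦ a ⊕ 𝟘 ⟧ ≐ ⟦ a ⟧
⊕-zero-≐ = (λ { (inj₁ p) → p ; (inj₂ ()) }) , inj₁

⊙-assoc-≐ : ⟦ (a ⊙ b) ⊙ c ⟧ ≐ ⟦ a ⊙ (b ⊙ c) ⟧
⊙-assoc-≐ = to , from
  where
  to : ⟦ (a ⊙ b) ⊙ c ⟧ ⊆ ⟦ a ⊙ (b ⊙ c) ⟧
  to (_ , w₃ , (w₁ , w₂ , p₁ , p₂ , refl) , p₃ , refl) =
    w₁ , w₂ ++ w₃ , p₁ , (w₂ , w₃ , p₂ , p₃ , refl) , ++-assoc w₁ w₂ w₃
  from : ⟦ a ⊙ (b ⊙ c) ⟧ ⊆ ⟦ (a ⊙ b) ⊙ c ⟧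
  from (w₁ , _ , p₁ , (w₂ , w₃ , p₂ , p₃ , refl) , refl) =
    w₁ ++ w₂ , w₃ , (w₁ , w₂ , p₁ , p₂ , refl) , p₃ , ≡.sym (++-assoc w₁ w₂ w₃)

⊙-unitˡ-≐ : ⟦ 𝟙 ⊙ a ⟧ ≐ ⟦ a ⟧
⊙-unitˡ-≐ = (λ { (_ , _ , refl , p , refl) → p }) , λ {w} p → [] , w , refl , p , refl

⊙-unitʳ-≐ : ⟦ a ⊙ 𝟙 ⟧ ≐ ⟦ a ⟧
⊙-unitʳ-≐ {a = a} = to , λ {w} p → w , [] , p , refl , ≡.sym (++-identityʳ w)
  where
  to : ⟦ a ⊙ 𝟙 ⟧ ⊆ ⟦ a ⟧
  to (w , _ , p , refl , refl) = subst ⟦ a ⟧ (≡.sym (++-identityʳ w)) p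

distribˡ-≐ : ⟦ a ⊙ (b ⊕ c) ⟧ ≐ ⟦ a ⊙ b ⊕ a ⊙ c ⟧
distribˡ-≐ = to , from
  where
  to : ⟦ a ⊙ (b ⊕ c) ⟧ ⊆ ⟦ a ⊙ b ⊕ a ⊙ c ⟧
  to (u , v , p , inj₁ q , eq) = inj₁ (u , v , p , q , eq)
  to (u , v , p , inj₂ q , eq) = inj₂ (u , v , p , q , eq)
  from : ⟦ a ⊙ b ⊕ a ⊙ c ⟧ ⊆ ⟦ a ⊙ (b ⊕ c) ⟧
  from (inj₁ (u , v , p , q , eq)) = u , v , p , inj₁ q , eq
  from (inj₂ (u , v , p , q , eq)) = u , v , p , inj₂ q , eq

distribʳ-≐ : ⟦ (a ⊕ b) ⊙ c ⟧ ≐ ⟦ a ⊙ c ⊕ b ⊙ c ⟧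
distribʳ-≐ = to , from
  where
  to : ⟦ (a ⊕ b) ⊙ c ⟧ ⊆ ⟦ a ⊙ c ⊕ b ⊙ c ⟧
  to (u , v , inj₁ p , q , eq) = inj₁ (u , v , p , q , eq)
  to (u , v , inj₂ p , q , eq) = inj₂ (u , v , p , q , eq)
  from : ⟦ a ⊙ c ⊕ b ⊙ c ⟧ ⊆ ⟦ (a ⊕ b) ⊙ c ⟧
  from (inj₁ (u , v , p , q , eq)) = u , v , inj₁ p , q , eq
  from (inj₂ (u , v , p , q , eq)) = u , v , inj₂ p , q , eq

annihilˡ-≐ : ⟦ 𝟘 ⊙ a ⟧ ≐ ⟦ 𝟘 {A} ⟧
annihilˡ-≐ = (λ { (_ , _ , () , _) }) , λ ()

annihilʳ-≐ : ⟦ a ⊙ 𝟘 ⟧ ≐ ⟦ 𝟘 {A} ⟧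
annihilʳ-≐ = (λ { (_ , _ , _ , () , _) }) , λ ()

⋆-unfold-≐ : ⟦ (𝟙 ⊕ a ⊙ a ⋆) ⊕ a ⋆ ⟧ ≐ ⟦ a ⋆ ⟧
⋆-unfold-≐ {a = a} = to , inj₂
  where
  to : ⟦ (𝟙 ⊕ a ⊙ a ⋆) ⊕ a ⋆ ⟧ ⊆ ⟦ a ⋆ ⟧
  to (inj₁ (inj₁ refl))                = nil
  to (inj₁ (inj₂ (_ , _ , p , q , eq))) = cons p q eq
  to (inj₂ p)                          = p

module ContextualOrder {A : Set} (K : Lang A) where

  -- A record rather than K (u ++ x ++ v), so that u, v and x can be inferred.
  record Residual (u v x : Word A) : Set where
    constructor ⟨_⟩
    field plugged : K (u ++ x ++ v)
  open Residual public

  infix 4 _⊑_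
  _⊑_ : Exp A → Exp A → Set
  a ⊑ b = ∀ u v → ⟦ b ⟧ ⊆ Residual u v → ⟦ a ⟧ ⊆ Residual u v

  Closed : Hyps A → Set
  Closed G = ∀ {a b} → G a b → a ⊑ b

  module _ {u v x y : Word A} where

    residual-splitʳ : Residual u v (x ++ y) → Residual u (y ++ v) x
    residual-splitʳ ⟨ k ⟩ = ⟨ subst K (cong (u ++_) (++-assoc x y v)) k ⟩

    residual-joinʳ : Residual u (y ++ v) x → Residual u v (x ++ y)
    residual-joinʳ ⟨ k ⟩ = ⟨ subst K (cong (u ++_) (≡.sym (++-assoc x y v))) k ⟩

    residual-splitˡ : Residual u v (x ++ y) → Residual (u ++ x) v y
    residual-splitˡ r = ⟨ subst K (≡.sym (++-assoc u x (y ++ v))) (plugged (residual-splitʳ r)) ⟩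

    residual-joinˡ : Residual (u ++ x) v y → Residual u v (x ++ y)
    residual-joinˡ ⟨ k ⟩ = residual-joinʳ ⟨ subst K (++-assoc u x (y ++ v)) k ⟩

    residual-reassocʳ : ∀ {w} → Residual u (x ++ y ++ v) w → Residual u ((x ++ y) ++ v) w
    residual-reassocʳ {w} ⟨ k ⟩ = ⟨ subst K (cong (λ t → u ++ w ++ t) (≡.sym (++-assoc x y v))) k ⟩

  ⊑-refl : a ⊑ a
  ⊑-refl u v = id

  ⊑-trans : a ⊑ b → b ⊑ c → a ⊑ c
  ⊑-trans a⊑b b⊑c u v = a⊑b u v ∘ b⊑c u v

  ⊆⇒⊑ : ⟦ a ⟧ ⊆ ⟦ b ⟧ → a ⊑ b
  ⊆⇒⊑ a⊆b u v b⊆K = b⊆K ∘ a⊆b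

  ≐⇒⊑ : ⟦ a ⟧ ≐ ⟦ b ⟧ → a ⊑ b × b ⊑ a
  ≐⇒⊑ (a⊆b , b⊆a) = ⊆⇒⊑ a⊆b , ⊆⇒⊑ b⊆a

  ⊑-⊕ˡ : a ⊑ a ⊕ b
  ⊑-⊕ˡ = ⊆⇒⊑ inj₁

  ⊑-⊕ʳ : b ⊑ a ⊕ b
  ⊑-⊕ʳ = ⊆⇒⊑ inj₂

  ⊕-lub : a ⊑ c → b ⊑ c → a ⊕ b ⊑ c
  ⊕-lub a⊑c b⊑c u v c⊆K (inj₁ p) = a⊑c u v c⊆K p
  ⊕-lub a⊑c b⊑c u v c⊆K (inj₂ p) = b⊑c u v c⊆K p

  ⊕-mono : a ⊑ a' → b ⊑ b' → a ⊕ b ⊑ a' ⊕ b'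
  ⊕-mono a⊑a' b⊑b' = ⊕-lub (⊑-trans a⊑a' ⊑-⊕ˡ) (⊑-trans b⊑b' ⊑-⊕ʳ)

  ⊕-absorb : a ⊑ b → a ⊕ b ⊑ b × b ⊑ a ⊕ b
  ⊕-absorb a⊑b = ⊕-lub a⊑b ⊑-refl , ⊑-⊕ʳ

  ⊙-monoˡ : a ⊑ a' → a ⊙ b ⊑ a' ⊙ b
  ⊙-monoˡ a⊑a' u v a'b⊆K (x₁ , x₂ , ax₁ , bx₂ , refl) =
    residual-joinʳ (a⊑a' u (x₂ ++ v) (λ {y} a'y → residual-splitʳ (a'b⊆K (y , x₂ , a'y , bx₂ , refl))) ax₁)

  ⊙-monoʳ : b ⊑ b' → a ⊙ b ⊑ a ⊙ b'
  ⊙-monoʳ b⊑b' u v ab'⊆K (x₁ , x₂ , ax₁ , bx₂ , refl) =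
    residual-joinˡ (b⊑b' (u ++ x₁) v (λ {y} b'y → residual-splitˡ (ab'⊆K (x₁ , y , ax₁ , b'y , refl))) bx₂)

  ⊙-mono : a ⊑ a' → b ⊑ b' → a ⊙ b ⊑ a' ⊙ b'
  ⊙-mono a⊑a' b⊑b' = ⊑-trans (⊙-monoˡ a⊑a') (⊙-monoʳ b⊑b')

  ⋆-mono : a ⊑ a' → a ⋆ ⊑ a' ⋆
  ⋆-mono {a = a} {a' = a'} a⊑a' u v a'⋆⊆K = go u a'⋆⊆K
    where
    go : ∀ {x} u → ⟦ a' ⋆ ⟧ ⊆ Residual u v → StarL ⟦ a ⟧ x → Residual u v x
    go u a'⋆⊆K nil = a'⋆⊆K nil
    go u a'⋆⊆K (cons {x₁} ax₁ ax' refl) =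
      residual-joinˡ (go (u ++ x₁) (λ {y} a'⋆y → residual-splitˡ (residual-joinʳ
        (a⊑a' u (y ++ v) (λ a'z → residual-splitʳ (a'⋆⊆K (cons a'z a'⋆y refl))) ax₁))) ax')

  ⋆⊙-⊑ : b ⊙ c ⊑ c → b ⋆ ⊙ c ⊑ c
  ⋆⊙-⊑ {b = b} {c = c} bc⊑c u v c⊆K (s , t , b⋆s , ct , refl) = residual-joinʳ (go u c⊆K b⋆s)
    where
    go : ∀ {s} u → ⟦ c ⟧ ⊆ Residual u v → StarL ⟦ b ⟧ s → Residual u (t ++ v) s
    go u c⊆K nil = ⟨ plugged (c⊆K ct) ⟩
    go u c⊆K (cons {s₁} bs₁ b⋆s' refl) =
      residual-joinˡ (go (u ++ s₁) (λ {w} cw → residual-splitˡ (bc⊑c u v c⊆K (s₁ , w , bs₁ , cw , refl))) b⋆s')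

  ⊙⋆-⊑ : c ⊙ b ⊑ c → c ⊙ b ⋆ ⊑ c
  ⊙⋆-⊑ {c = c} {b = b} cb⊑c u v c⊆K (t , s , ct , b⋆s , refl) = residual-joinʳ (go v c⊆K b⋆s ct)
    where
    go : ∀ {s} v → ⟦ c ⟧ ⊆ Residual u v → StarL ⟦ b ⟧ s → ⟦ c ⟧ ⊆ Residual u (s ++ v)
    go v c⊆K nil = c⊆K
    go v c⊆K (cons {s₁} {s'} bs₁ b⋆s' refl) {w} cw =
      residual-reassocʳ {x = s₁} (residual-splitʳ (cb⊑c u (s' ++ v) (go v c⊆K b⋆s') (w , s₁ , cw , bs₁ , refl)))

  module _ {G : Hyps A} (closed : Closed G) where

    sound : G ⊢ a ≈ b → a ⊑ b × b ⊑ a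
    sound refl           = ⊑-refl , ⊑-refl
    sound (sym d)        = swap (sound d)
    sound (trans d e)    = zip′ ⊑-trans (flip ⊑-trans) (sound d) (sound e)
    sound (⊕-cong d e)   = zip′ ⊕-mono ⊕-mono (sound d) (sound e)
    sound (⊙-cong d e)   = zip′ ⊙-mono ⊙-mono (sound d) (sound e)
    sound (⋆-cong d)     = map ⋆-mono ⋆-mono (sound d)
    sound ⊕-assoc        = ≐⇒⊑ ⊕-assoc-≐
    sound ⊕-comm         = ⊆⇒⊑ ⊕-comm-⊆ , ⊆⇒⊑ ⊕-comm-⊆
    sound ⊕-idem         = ≐⇒⊑ ⊕-idem-≐
    sound ⊕-zero         = ≐⇒⊑ ⊕-zero-≐
    sound ⊙-assoc        = ≐⇒⊑ ⊙-assoc-≐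
    sound (⊙-unitˡ {x})  = ≐⇒⊑ {a = 𝟙 ⊙ x} ⊙-unitˡ-≐
    sound (⊙-unitʳ {x})  = ≐⇒⊑ {a = x ⊙ 𝟙} ⊙-unitʳ-≐
    sound distribˡ       = ≐⇒⊑ distribˡ-≐
    sound distribʳ       = ≐⇒⊑ distribʳ-≐
    sound annihilˡ       = ≐⇒⊑ annihilˡ-≐
    sound annihilʳ       = ≐⇒⊑ annihilʳ-≐
    sound (⋆-unfold {x}) = ≐⇒⊑ {a = (𝟙 ⊕ x ⊙ x ⋆) ⊕ x ⋆} ⋆-unfold-≐
    sound (⋆-indˡ {x} {y} {z} d) =
      ⊕-absorb (⊑-trans (⊙-monoʳ (⊑-trans ⊑-⊕ˡ premise)) (⋆⊙-⊑ (⊑-trans ⊑-⊕ʳ premise)))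
      where
      premise : x ⊕ y ⊙ z ⊑ z
      premise = ⊑-trans ⊑-⊕ˡ (proj₁ (sound d))
    sound (⋆-indʳ {x} {y} {z} d) =
      ⊕-absorb (⊑-trans (⊙-monoˡ (⊑-trans ⊑-⊕ˡ premise)) (⊙⋆-⊑ (⊑-trans ⊑-⊕ʳ premise)))
      where
      premise : x ⊕ y ⊙ z ⊑ y
      premise = ⊑-trans ⊑-⊕ˡ (proj₁ (sound d))
    sound (hyp g)        = ⊕-absorb (closed g)

  closed-⊢ₕ : G ⊢ₕ G' → Closed G → Closed G'
  closed-⊢ₕ G⊢G' closed g' = ⊑-trans ⊑-⊕ˡ (proj₁ (sound closed (G⊢G' g')))

open ContextualOrder using (⟨_⟩; plugged; Closed; closed-⊢ₕ)

closure-closed : Closed (Closure G L) G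
closure-closed g u v f⊆K ex = ⟨ step {u = u} {v} g (λ _ → plugged ∘ f⊆K) ex refl ⟩

closure-least : ∀ {K} → Closed K G → L ⊆ K → Closure G L ⊆ K
closure-least closed L⊆K (base p) = L⊆K p
closure-least closed L⊆K (step {u = u} {v} g f⊆C ex refl) =
  plugged (closed g u v (λ fy → ⟨ closure-least closed L⊆K (f⊆C _ fy) ⟩) ex)

closure-mono : L ⊆ L' → Closure G L ⊆ Closure G L'
closure-mono L⊆L' = closure-least closure-closed (base ∘ L⊆L')

closure-idem : Closure G (Closure G L) ⊆ Closure G L
closure-idem = closure-least closure-closed id

⊢ₕ⇒closure-⊆ : G ⊢ₕ G' → Closure G' L ⊆ Closure G L
⊢ₕ⇒closure-⊆ G⊢G' = closure-least (closed-⊢ₕ _ G⊢G' closure-closed) base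

⊢-weaken : G ⇒ G' → G ⊢ a ≈ b → G' ⊢ a ≈ b
⊢-weaken G⇒G' refl         = refl
⊢-weaken G⇒G' (sym d)      = sym (⊢-weaken G⇒G' d)
⊢-weaken G⇒G' (trans d e)  = trans (⊢-weaken G⇒G' d) (⊢-weaken G⇒G' e)
⊢-weaken G⇒G' (⊕-cong d e) = ⊕-cong (⊢-weaken G⇒G' d) (⊢-weaken G⇒G' e)
⊢-weaken G⇒G' (⊙-cong d e) = ⊙-cong (⊢-weaken G⇒G' d) (⊢-weaken G⇒G' e)
⊢-weaken G⇒G' (⋆-cong d)   = ⋆-cong (⊢-weaken G⇒G' d)
⊢-weaken G⇒G' ⊕-assoc      = ⊕-assoc
⊢-weaken G⇒G' ⊕-comm       = ⊕-comm
⊢-weaken G⇒G' ⊕-idem       = ⊕-idem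
⊢-weaken G⇒G' ⊕-zero       = ⊕-zero
⊢-weaken G⇒G' ⊙-assoc      = ⊙-assoc
⊢-weaken G⇒G' ⊙-unitˡ      = ⊙-unitˡ
⊢-weaken G⇒G' ⊙-unitʳ      = ⊙-unitʳ
⊢-weaken G⇒G' distribˡ     = distribˡ
⊢-weaken G⇒G' distribʳ     = distribʳ
⊢-weaken G⇒G' annihilˡ     = annihilˡ
⊢-weaken G⇒G' annihilʳ     = annihilʳ
⊢-weaken G⇒G' ⋆-unfold     = ⋆-unfold
⊢-weaken G⇒G' (⋆-indˡ d)   = ⋆-indˡ (⊢-weaken G⇒G' d)
⊢-weaken G⇒G' (⋆-indʳ d)   = ⋆-indʳ (⊢-weaken G⇒G' d)
⊢-weaken G⇒G' (hyp g)      = hyp (G⇒G' g)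

reduct : {G G' : Hyps A} → Reduces G G' → Exp A → Exp A
reduct (_ , r , _) = r

reduct-≈ : (red : Reduces G G') → ∀ e → G ⊢ e ≈ reduct red e
reduct-≈ (_ , _ , spec) e = proj₁ (spec e)

reduct-closure : (red : Reduces G G') → ∀ e → Closure G ⟦ e ⟧ ⊆ Closure G' ⟦ reduct red e ⟧
reduct-closure (_ , _ , spec) e = proj₂ (spec e) _

closure-into-reduct : (red : Reduces G G') → L ⊆ Closure G' ⟦ e ⟧ → Closure G L ⊆ Closure G' ⟦ reduct red e ⟧
closure-into-reduct red L⊆G'⋆e =
  reduct-closure red _ ∘ closure-idem ∘ closure-mono (⊢ₕ⇒closure-⊆ (proj₁ red) ∘ L⊆G'⋆e)

module _ {H' : Hyps A} where

  chain-reduct : ∀ n {H : Fin (suc n) → Hyps A} → (∀ i → Reduces (H i) H') → Exp A → Exp A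
  chain-reduct zero    red = reduct (red (fromℕ zero))
  chain-reduct (suc n) red = reduct (red (fromℕ (suc n))) ∘ chain-reduct n (red ∘ inject₁)

  chain-reduct-≈ : ∀ n {H : Fin (suc n) → Hyps A} (red : ∀ i → Reduces (H i) H')
                 → (∀ i → H i ⇒ G) → ∀ e → G ⊢ e ≈ chain-reduct n red e
  chain-reduct-≈ zero    red H⇒G e = ⊢-weaken (H⇒G (fromℕ zero)) (reduct-≈ (red (fromℕ zero)) e)
  chain-reduct-≈ (suc n) red H⇒G e =
    trans (chain-reduct-≈ n (red ∘ inject₁) (H⇒G ∘ inject₁) e)
          (⊢-weaken (H⇒G (fromℕ (suc n))) (reduct-≈ (red (fromℕ (suc n))) _))

  chain-reduct-closure : ∀ n {H : Fin (suc n) → Hyps A} (red : ∀ i → Reduces (H i) H')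
                       → ∀ e → ComposeClo n H ⟦ e ⟧ ⊆ Closure H' ⟦ chain-reduct n red e ⟧
  chain-reduct-closure zero    red e = reduct-closure (red (fromℕ zero)) e
  chain-reduct-closure (suc n) red e =
    closure-into-reduct (red (fromℕ (suc n))) (chain-reduct-closure n (red ∘ inject₁) e)

proposition5p1 : {A : Set} (n : ℕ) (H : Fin (suc n) → Hyps A) (H' : Hyps A)
    → (∀ i → Reduces (H i) H')
    → (∀ (L : Lang A) w → Closure (⋃ n H) L w → ComposeClo n H L w)
    → Reduces (⋃ n H) H'
proposition5p1 n H H' red H⋆⊆composite =
  ⊢-weaken (fromℕ n ,_) ∘ proj₁ (red (fromℕ n)) ,
  chain-reduct n red ,
  λ e → chain-reduct-≈ n red (λ i → i ,_) e ,
        λ w → chain-reduct-closure n red e ∘ H⋆⊆composite ⟦ e ⟧ w
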